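{- Let $M:\Delta_n\to\mathbb Z$ be a quasi-hive. For $1\le i\le n-1$, $\widehat{t_i(M)}=s_i(\widehat M)$; moreover $\widehat{t_0(M)}=\widehat M$.
   Context: $\Delta_n=\{(x,y,z)\in\mathbb Z^3_{\ge0}:x+y+z=n\}$. A quasi-hive is a function $M:\Delta_n\to\mathbb Z$ (modulo constants) satisfying, whenever all points lie in $\Delta_n$, (i) $M(x,y,z)+M(x,y+1,z-1)\ge M(x+1,y,z-1)+M(x-1,y+1,z)$ and (ii) $M(x,y,z)+M(x+1,y,z-1)\ge M(x,y+1,z-1)+M(x+1,y-1,z)$. For any function $M$ on $\Delta_n$, $\widehat M(i,j)=M(i-j,j,n-i)-M(i-j+1,j-1,n-i)$, $1\le j\le i\le n$; for a quasi-hive it is a Gelfand–Tsetlin pattern (an array with $T(i,j)\ge T(i-1,j)\ge T(i,j+1)$). The operations $t_i$ (arising from one step of the modified octahedron recurrence): for $1\le i\le n-1$, $t_i(M)(x,y,z)=M(x,y,z)$ if $z\ne n-i$, and for $z=n-i$ (so $x+y=i$): if $x>0,y>0$, $t_i(M)(x,y,n-i)=\max\big(M(x+1,y,n-i-1)+M(x-1,y,n-i+1),\,M(x,y+1,n-i-1)+M(x,y-1,n-i+1)\big)-M(x,y,n-i)$; if $y=0$, $t_i(M)(i,0,n-i)=M(i+1,0,n-i-1)+M(i-1,0,n-i+1)-M(i,0,n-i)$; if $x=0$, $t_i(M)(0,i,n-i)=M(0,i+1,n-i-1)+M(0,i-1,n-i+1)-M(0,i,n-i)$. Also $t_0(M)$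 agrees with $M$ except $t_0(M)(0,0,n)=M(1,0,n-1)+M(0,1,n-1)-M(0,0,n)$. (Equivalently: placing $M$ in space-time along a standard $i$-flippable embedding $(x,y,z)\mapsto(x,y,h(z))$ and computing the values on its $i$-flip by the modified octahedron recurrence.) Bender–Knuth move $s_i$ ($1\le i\le n-1$) on a Gelfand–Tsetlin pattern $T$: $s_i(T)(k,j)=T(k,j)$ for $k\ne i$ and $s_i(T)(i,j)=\min(T(i+1,j),T(i-1,j-1))+\max(T(i+1,j+1),T(i-1,j))-T(i,j)$, where an undefined argument ($j=1$ or $j=i$) is omitted from the min/max. -}

module Defs where

open import Data.Nat using (ℕ; zero; suc; _+_; _∸_; _≤_; _<_; _≟_)
open import Data.Integer using (ℤ; _⊓_; _⊔_) renaming (_+_ to _+ℤ_; _-_ to _-ℤ_; _≤_ to _≤ℤ_)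
open import Relation.Binary.PropositionalEquality using (_≡_)
open import Relation.Nullary using (yes; no)

-- A function on the triangle Δ_n is represented by a total function ℕ³ → ℤ;
-- only its values at points (x,y,z) with x + y + z ≡ n are ever used.
Fun3 : Set
Fun3 = ℕ → ℕ → ℕ → ℤ

-- Quasi-hive inequalities (i) and (ii), imposed whenever all four points lie in Δ_n.
-- (i): points (x,y,z),(x,y+1,z-1),(x+1,y,z-1),(x-1,y+1,z) lie in Δ_n iff x+y+z=n, x≥1, z≥1.
-- (ii): points (x,y,z),(x+1,y,z-1),(x,y+1,z-1),(x+1,y-1,z) lie in Δ_n iff x+y+z=n, y≥1, z≥1.
record QuasiHive (n : ℕ) (M : Fun3) : Set where
  field
    rhombus₁ : ∀ x y z → x + y + z ≡ n → 1 ≤ x → 1 ≤ z →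
      M (suc x) y (z ∸ 1) +ℤ M (x ∸ 1) (suc y) z ≤ℤ M x y z +ℤ M x (suc y) (z ∸ 1)
    rhombus₂ : ∀ x y z → x + y + z ≡ n → 1 ≤ y → 1 ≤ z →
      M x (suc y) (z ∸ 1) +ℤ M (suc x) (y ∸ 1) z ≤ℤ M x y z +ℤ M (suc x) y (z ∸ 1)

-- Gelfand–Tsetlin arrays are functions ℕ → ℕ → ℤ, used at 1 ≤ j ≤ i ≤ n.
Pattern : Set
Pattern = ℕ → ℕ → ℤ

hat : ℕ → Fun3 → Pattern
hat n M i j = M (i ∸ j) j (n ∸ i) -ℤ M (suc (i ∸ j)) (j ∸ 1) (n ∸ i)

tval : ℕ → ℕ → Fun3 → ℕ → ℕ → ℤ
tval n i M zero y =
  M 0 (suc y) (n ∸ i ∸ 1) +ℤ M 0 (y ∸ 1) (suc (n ∸ i)) -ℤ M 0 y (n ∸ i)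
tval n i M (suc x) zero =
  M (suc (suc x)) 0 (n ∸ i ∸ 1) +ℤ M x 0 (suc (n ∸ i)) -ℤ M (suc x) 0 (n ∸ i)
tval n i M (suc x) (suc y) =
  ((M (suc (suc x)) (suc y) (n ∸ i ∸ 1) +ℤ M x (suc y) (suc (n ∸ i)))
    ⊔ (M (suc x) (suc (suc y)) (n ∸ i ∸ 1) +ℤ M (suc x) y (suc (n ∸ i))))
  -ℤ M (suc x) (suc y) (n ∸ i)

t : ℕ → ℕ → Fun3 → Fun3
t n i M x y z with z ≟ n ∸ i
... | yes _ = tval n i M x y
... | no _ = M x y z

t₀ : ℕ → Fun3 → Fun3
t₀ n M zero zero z with z ≟ n
... | yes _ = M 1 0 (n ∸ 1) +ℤ M 0 1 (n ∸ 1) -ℤ M 0 0 n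
... | no _ = M 0 0 z
t₀ n M zero (suc y) z = M zero (suc y) z
t₀ n M (suc x) y z = M (suc x) y z

-- Bender–Knuth move s_i; undefined arguments omitted from min/max:
-- T(i-1,j-1) is undefined iff j = 1, T(i-1,j) is undefined iff j = i.
bkMin : ℕ → Pattern → ℕ → ℤ
bkMin i T zero = T (suc i) zero          -- never used (j ≥ 1)
bkMin i T (suc zero) = T (suc i) 1
bkMin i T (suc (suc j)) = T (suc i) (suc (suc j)) ⊓ T (i ∸ 1) (suc j)

bkMax : ℕ → Pattern → ℕ → ℤ
bkMax i T j with j ≟ i
... | yes _ = T (suc i) (suc j)
... | no _ = T (suc i) (suc j) ⊔ T (i ∸ 1) j

s : ℕ → Pattern → Pattern
s i T k j with k ≟ i
... | yes _ = bkMin i T j +ℤ bkMax i T j -ℤ T i j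
... | no _ = T k j

-- Write u, p, d for M on the levels n-i-1, n-i, n-i+1, which M̂ reads as its rows i+1, i, i-1.
-- t_i changes only p, replacing p(x,y) by max(u(x+1,y) + d(x-1,y), u(x,y+1) + d(x,y-1)) − p(x,y).
-- The entry M̂(i,j) = p(x,j) − p(x+1,j-1), x = i-j, thus involves two such maxima, and they share
-- the summands U = u(x+1,j) and D = d(x,j-1).  Factoring U + D out of them gives
-- U + D + max(M̂(i+1,j+1), M̂(i-1,j)) and U + D − min(M̂(i+1,j), M̂(i-1,j-1)), whose difference
-- is the Bender–Knuth move.  On the boundary of Δ_n a term is missing from a maximum exactly
-- when the corresponding undefined entry is omitted from the min or max.
module Submission where

open import Data.Nat using (ℕ; zero; suc; _+_; _∸_; _≤_; _<_; _≟_; s≤s)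
open import Data.Nat.Properties
  using (+-suc; +-∸-assoc; m+n∸n≡m; m∸n+n≡m; ∸-cancelˡ-≡; <⇒≤; ≤-trans; ≟-diag; m≢1+n+m)
open import Data.Integer using (_⊓_; _⊔_; -_) renaming (_+_ to _+ℤ_; _-_ to _-ℤ_)
open import Data.Integer.Properties using (mono-≤-distrib-⊔; +-monoʳ-≤; ⊔-comm; neg-distrib-⊓-⊔)
open import Data.Integer.Tactic.RingSolver using (solve-∀)
open import Data.Product using (_×_; _,_)
open import Relation.Nullary using (¬_; Dec; yes; no)
open import Relation.Nullary.Decidable using (dec-no)
open import Relation.Binary.PropositionalEquality
  using (_≡_; refl; sym; trans; cong; cong₂; module ≡-Reasoning)

open import Defs

+-distribˡ-⊔ : ∀ k a b → k +ℤ (a ⊔ b) ≡ (k +ℤ a) ⊔ (k +ℤ b)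
+-distribˡ-⊔ k = mono-≤-distrib-⊔ (+-monoʳ-≤ k)

+-⊔-factor : ∀ U D a c → (U +ℤ a) ⊔ (c +ℤ D) ≡ (U +ℤ D) +ℤ ((c -ℤ U) ⊔ (a -ℤ D))
+-⊔-factor U D a c = begin
  (U +ℤ a) ⊔ (c +ℤ D)
    ≡⟨ cong₂ _⊔_ (regroupˡ U D a) (regroupʳ U D c) ⟩
  ((U +ℤ D) +ℤ (a -ℤ D)) ⊔ ((U +ℤ D) +ℤ (c -ℤ U))
    ≡⟨ sym (+-distribˡ-⊔ (U +ℤ D) _ _) ⟩
  (U +ℤ D) +ℤ ((a -ℤ D) ⊔ (c -ℤ U))
    ≡⟨ cong ((U +ℤ D) +ℤ_) (⊔-comm (a -ℤ D) (c -ℤ U)) ⟩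
  (U +ℤ D) +ℤ ((c -ℤ U) ⊔ (a -ℤ D)) ∎
  where
  open ≡-Reasoning
  regroupˡ : ∀ U D a → U +ℤ a ≡ (U +ℤ D) +ℤ (a -ℤ D)
  regroupˡ = solve-∀
  regroupʳ : ∀ U D c → c +ℤ D ≡ (U +ℤ D) +ℤ (c -ℤ U)
  regroupʳ = solve-∀

+-⊔-factor-⊓ : ∀ U D c d → (c +ℤ D) ⊔ (U +ℤ d) ≡ (U +ℤ D) -ℤ ((U -ℤ c) ⊓ (D -ℤ d))
+-⊔-factor-⊓ U D c d = begin
  (c +ℤ D) ⊔ (U +ℤ d)
    ≡⟨ cong₂ _⊔_ (regroupˡ U D c) (regroupʳ U D d) ⟩
  ((U +ℤ D) +ℤ - (U -ℤ c)) ⊔ ((U +ℤ D) +ℤ - (D -ℤ d))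
    ≡⟨ sym (+-distribˡ-⊔ (U +ℤ D) _ _) ⟩
  (U +ℤ D) +ℤ (- (U -ℤ c) ⊔ - (D -ℤ d))
    ≡⟨ cong ((U +ℤ D) +ℤ_) (sym (neg-distrib-⊓-⊔ _ _)) ⟩
  (U +ℤ D) -ℤ ((U -ℤ c) ⊓ (D -ℤ d)) ∎
  where
  open ≡-Reasoning
  regroupˡ : ∀ U D c → c +ℤ D ≡ (U +ℤ D) +ℤ - (U -ℤ c)
  regroupˡ = solve-∀
  regroupʳ : ∀ U D d → U +ℤ d ≡ (U +ℤ D) +ℤ - (D -ℤ d)
  regroupʳ = solve-∀

∸-suc-step : ∀ {m n} → n < m → m ∸ n ≡ suc (m ∸ suc n)
∸-suc-step {suc m} (s≤s n≤m) = +-∸-assoc 1 n≤m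

-- Naming the level of row i+1 as b lets tval's n ∸ i ∸ 1 and suc (n ∸ i) compute to b and 2+b.
record RowHeights (n i b : ℕ) : Set where
  field
    row   : n ∸ i ≡ suc b
    row+1 : n ∸ suc i ≡ b
    row-1 : n ∸ (i ∸ 1) ≡ suc (suc b)

rowHeights : ∀ {n i} → 1 ≤ i → i < n → RowHeights n i (n ∸ suc i)
rowHeights {i = suc m} (s≤s _) i<n = record
  { row   = ∸-suc-step i<n
  ; row+1 = refl
  ; row-1 = trans (∸-suc-step (<⇒≤ i<n)) (cong suc (∸-suc-step i<n))
  }

hat-at : ∀ n (M : Fun3) {k z} x y → k ≡ x + suc y → n ∸ k ≡ z →
  hat n M k (suc y) ≡ M x (suc y) z -ℤ M (suc x) y z
hat-at n M x y refl refl rewrite m+n∸n≡m x (suc y) = refl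

t-on-level : ∀ n i M x y → t n i M x y (n ∸ i) ≡ tval n i M x y
t-on-level n i M x y rewrite ≟-diag (refl {x = n ∸ i}) = refl

t-off-level : ∀ n i M x y z → ¬ z ≡ n ∸ i → t n i M x y z ≡ M x y z
t-off-level n i M x y z z≢ rewrite dec-no (z ≟ n ∸ i) z≢ = refl

s-on-row : ∀ i T j → s i T i j ≡ bkMin i T j +ℤ bkMax i T j -ℤ T i j
s-on-row i T j rewrite ≟-diag (refl {x = i}) = refl

s-off-row : ∀ i T k j → ¬ k ≡ i → s i T k j ≡ T k j
s-off-row i T k j k≢i rewrite dec-no (k ≟ i) k≢i = refl

bkMax-last : ∀ i T → bkMax i T i ≡ T (suc i) (suc i)
bkMax-last i T rewrite ≟-diag (refl {x = i}) = refl

bkMax-inner : ∀ i T j → ¬ j ≡ i → bkMax i T j ≡ T (suc i) (suc j) ⊔ T (i ∸ 1) j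
bkMax-inner i T j j≢i rewrite dec-no (j ≟ i) j≢i = refl

module _ (n : ℕ) (M : Fun3) where

  tval-via-bkMax : ∀ x y {b} → RowHeights n (x + suc y) b →
    tval n (x + suc y) M x (suc y)
      ≡ M (suc x) (suc y) b +ℤ M x y (suc (suc b)) +ℤ bkMax (x + suc y) (hat n M) (suc y)
          -ℤ M x (suc y) (suc b)
  tval-via-bkMax zero y {b} h rewrite RowHeights.row h =
    trans (regroup U D c P) (cong (λ m → U +ℤ D +ℤ m -ℤ P) (sym bkMax≡))
    where
    U = M 1 (suc y) b
    D = M 0 y (suc (suc b))
    c = M 0 (suc (suc y)) b
    P = M 0 (suc y) (suc b)
    regroup : ∀ U D c P → c +ℤ D -ℤ P ≡ U +ℤ D +ℤ (c -ℤ U) -ℤ P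
    regroup = solve-∀
    bkMax≡ : bkMax (suc y) (hat n M) (suc y) ≡ c -ℤ U
    bkMax≡ = trans (bkMax-last (suc y) (hat n M))
                   (hat-at n M 0 (suc y) refl (RowHeights.row+1 h))
  tval-via-bkMax (suc x) y {b} h rewrite RowHeights.row h =
    trans (cong (_-ℤ P) (+-⊔-factor U D a c)) (cong (λ m → U +ℤ D +ℤ m -ℤ P) (sym bkMax≡))
    where
    U = M (suc (suc x)) (suc y) b
    D = M (suc x) y (suc (suc b))
    a = M x (suc y) (suc (suc b))
    c = M (suc x) (suc (suc y)) b
    P = M (suc x) (suc y) (suc b)
    bkMax≡ : bkMax (suc x + suc y) (hat n M) (suc y) ≡ (c -ℤ U) ⊔ (a -ℤ D)
    bkMax≡ = trans (bkMax-inner (suc x + suc y) (hat n M) (suc y) (m≢1+n+m (suc y)))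
      (cong₂ _⊔_ (hat-at n M (suc x) (suc y) (sym (+-suc (suc x) (suc y))) (RowHeights.row+1 h))
                 (hat-at n M x y refl (RowHeights.row-1 h)))

  tval-via-bkMin : ∀ x y {b} → RowHeights n (x + suc y) b →
    tval n (x + suc y) M (suc x) y
      ≡ M (suc x) (suc y) b +ℤ M x y (suc (suc b)) -ℤ bkMin (x + suc y) (hat n M) (suc y)
          -ℤ M (suc x) y (suc b)
  tval-via-bkMin x zero {b} h rewrite RowHeights.row h =
    trans (regroup U D u P) (cong (λ m → U +ℤ D -ℤ m -ℤ P) (sym bkMin≡))
    where
    U = M (suc x) 1 b
    D = M x 0 (suc (suc b))
    u = M (suc (suc x)) 0 b
    P = M (suc x) 0 (suc b)
    regroup : ∀ U D u P → u +ℤ D -ℤ P ≡ U +ℤ D -ℤ (U -ℤ u) -ℤ P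
    regroup = solve-∀
    bkMin≡ : bkMin (x + 1) (hat n M) 1 ≡ U -ℤ u
    bkMin≡ = hat-at n M (suc x) 0 refl (RowHeights.row+1 h)
  tval-via-bkMin x (suc y) {b} h rewrite RowHeights.row h =
    trans (cong (_-ℤ P) (+-⊔-factor-⊓ U D c d)) (cong (λ m → U +ℤ D -ℤ m -ℤ P) (sym bkMin≡))
    where
    U = M (suc x) (suc (suc y)) b
    D = M x (suc y) (suc (suc b))
    c = M (suc (suc x)) (suc y) b
    d = M (suc x) y (suc (suc b))
    P = M (suc x) (suc y) (suc b)
    bkMin≡ : bkMin (x + suc (suc y)) (hat n M) (suc (suc y)) ≡ (U -ℤ c) ⊓ (D -ℤ d)
    bkMin≡ = cong₂ _⊓_ (hat-at n M (suc x) (suc y) refl (RowHeights.row+1 h))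
                       (hat-at n M x y (cong (_∸ 1) (+-suc x (suc y))) (RowHeights.row-1 h))

  hat-t-at : ∀ {i b} x y → i ≡ x + suc y → RowHeights n i b →
    hat n (t n i M) i (suc y) ≡ s i (hat n M) i (suc y)
  hat-t-at {b = b} x y refl h = begin
    hat n (t n i M) i (suc y)
      ≡⟨ hat-at n (t n i M) x y refl refl ⟩
    t n i M x (suc y) (n ∸ i) -ℤ t n i M (suc x) y (n ∸ i)
      ≡⟨ cong₂ _-ℤ_ (t-on-level n i M x (suc y)) (t-on-level n i M (suc x) y) ⟩
    tval n i M x (suc y) -ℤ tval n i M (suc x) y
      ≡⟨ cong₂ _-ℤ_ (tval-via-bkMax x y h) (tval-via-bkMin x y h) ⟩
    (S +ℤ bkMax i T (suc y) -ℤ P) -ℤ (S -ℤ bkMin i T (suc y) -ℤ Q)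
      ≡⟨ cancel S (bkMax i T (suc y)) (bkMin i T (suc y)) P Q ⟩
    bkMin i T (suc y) +ℤ bkMax i T (suc y) -ℤ (P -ℤ Q)
      ≡⟨ cong (bkMin i T (suc y) +ℤ bkMax i T (suc y) -ℤ_)
              (sym (hat-at n M x y refl (RowHeights.row h))) ⟩
    bkMin i T (suc y) +ℤ bkMax i T (suc y) -ℤ T i (suc y)
      ≡⟨ sym (s-on-row i T (suc y)) ⟩
    s i T i (suc y) ∎
    where
    open ≡-Reasoning
    i = x + suc y
    T = hat n M
    S = M (suc x) (suc y) b +ℤ M x y (suc (suc b))
    P = M x (suc y) (suc b)
    Q = M (suc x) y (suc b)
    cancel : ∀ S X Y P Q → (S +ℤ X -ℤ P) -ℤ (S -ℤ Y -ℤ Q) ≡ Y +ℤ X -ℤ (P -ℤ Q)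
    cancel = solve-∀

  hat-t-same-row : ∀ i j → 1 ≤ j → j ≤ i → i < n → hat n (t n i M) i j ≡ s i (hat n M) i j
  hat-t-same-row i (suc y) 1≤j j≤i i<n =
    hat-t-at (i ∸ suc y) y (sym (m∸n+n≡m j≤i)) (rowHeights (≤-trans 1≤j j≤i) i<n)

  hat-t-other-row : ∀ i k j → i ≤ n → k ≤ n → ¬ k ≡ i → hat n (t n i M) k j ≡ s i (hat n M) k j
  hat-t-other-row i k j i≤n k≤n k≢i = begin
    hat n (t n i M) k j
      ≡⟨ cong₂ _-ℤ_ (t-off-level n i M (k ∸ j) j (n ∸ k) height≢)
                    (t-off-level n i M (suc (k ∸ j)) (j ∸ 1) (n ∸ k) height≢) ⟩
    hat n M k j
      ≡⟨ sym (s-off-row i (hat n M) k j k≢i) ⟩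
    s i (hat n M) k j ∎
    where
    open ≡-Reasoning
    height≢ : ¬ n ∸ k ≡ n ∸ i
    height≢ e = k≢i (∸-cancelˡ-≡ k≤n i≤n e)

  hat-t : ∀ i k j → i < n → 1 ≤ j → j ≤ k → k ≤ n → hat n (t n i M) k j ≡ s i (hat n M) k j
  hat-t i k j i<n 1≤j j≤k k≤n = by-row (k ≟ i)
    where
    by-row : Dec (k ≡ i) → hat n (t n i M) k j ≡ s i (hat n M) k j
    by-row (yes refl) = hat-t-same-row k j 1≤j j≤k i<n
    by-row (no k≢i)   = hat-t-other-row i k j (<⇒≤ i<n) k≤n k≢i

  t₀-off-axis : ∀ x y z → t₀ n M x (suc y) z ≡ M x (suc y) z
  t₀-off-axis zero    y z = refl
  t₀-off-axis (suc x) y z = refl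

  hat-t₀ : ∀ k j → 1 ≤ j → hat n (t₀ n M) k j ≡ hat n M k j
  hat-t₀ k (suc y) _ =
    cong (_-ℤ M (suc (k ∸ suc y)) y (n ∸ k)) (t₀-off-axis (k ∸ suc y) y (n ∸ k))

proposition7p16 : (n : ℕ) (M : Fun3) → QuasiHive n M →
    ((i : ℕ) → 1 ≤ i → i < n → (k j : ℕ) → 1 ≤ j → j ≤ k → k ≤ n →
      hat n (t n i M) k j ≡ s i (hat n M) k j)
    × ((k j : ℕ) → 1 ≤ j → j ≤ k → k ≤ n → hat n (t₀ n M) k j ≡ hat n M k j)
proposition7p16 n M _ =
  (λ i _ i<n k j → hat-t n M i k j i<n) , (λ k j 1≤j _ _ → hat-t₀ n M k j 1≤j)
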